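{- Assume the setting described in the context. For every $v\in\{0,\dots,\tau-1\}$, $$N_v=l^{\overline{E}_{v,\tau}}\,\mu_{v,\tau}-m^{F_{v,\tau}}\,\lambda_{v,\tau}.$$
   Context: Setting. Let $m,l\ge 2$ be coprime integers and $\tau\ge1$ an integer. Let $f_0,\dots,f_{\tau-1}$ be positive integers. Let $(a_{v,i})$, $v\in\{0,\dots,\tau-1\}$, $i\in\{0,\dots,l-1\}$, be integers with $a_{v,0}=0$ and, for $i\neq0$: $a_{v,i}\equiv -m^{f_v}i \pmod l$, $a_{v,i}\not\equiv0\pmod m$ and $a_{v,i}\not\equiv 0\pmod l$. For each $v\in\{0,\dots,\tau-1\}$ fix an admissible choice: an index $i_v\in\{1,\dots,l-1\}$, with $a_v:=a_{v,i_v}$; an integer $s_v$ with $1\le s_v\le m^{f_v}-1$ and $\gcd(s_v,m)=1$; and positive integers $e_v,r_v$ with $r_v\equiv i_v\pmod l$, $l^{e_v}s_v=m^{f_v}r_v+a_v$, and $|a_v|<\max(m^{f_v},l^{e_v})$. All indexed quantities are extended $\tau$-periodically to all integer indices. Sums. For $v\in\mathbb Z$, $u\ge0$: $F_{v,u}=\sum_{y=0}^{u-1}f_{v+y}$, $\overline{E}_{v,u}=\sum_{y=0}^{u-1}e_{v-1-y}$. Let $N_v=\sum_{w=0}^{\tau-1}m^{F_{v,w}}l^{\overline{E}_{v,\tau-1-w}}a_{v+w}$ and $D_v=l^{\overline{E}_{v,\tau}}-m^{F_{v,\tau}}$. Iterates. Let $\mathbb Z_{\langle m,l\rangle}$ be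 the subring of $\mathbb Q$ of fractions whose denominators are coprime to both $m$ and $l$. Let $(n_v)_{v\in\mathbb Z}$ be a $\tau$-periodic sequence in $\mathbb Z_{\langle m,l\rangle}$ with $n_v\equiv s_v\pmod{m^{f_v}}$ and $n_{v+1}=l^{e_v}\frac{n_v-s_v}{m^{f_v}}+r_v$ for all $v$. Graded digits. $k_{v,0}=n_v$, $k_{v,u}=m^{f_{v+u}}k_{v,u+1}+d_{v,u}$ with $d_{v,u}\in\{0,\dots,m^{f_{v+u}}-1\}$, $k_{v,u+1}\in\mathbb Z_{\langle m,l\rangle}$; $j_{v,0}=n_v$, $j_{v,u}=l^{e_{v-1-u}}j_{v,u+1}+b_{v,u}$ with $b_{v,u}\in\{0,\dots,l^{e_{v-1-u}}-1\}$, $j_{v,u+1}\in\mathbb Z_{\langle m,l\rangle}$. Residues. $\mu_{v,u}=\sum_{w=0}^{u-1}m^{F_{v,w}}d_{v,w}$ (the $\mathbf m$-residue of index $u$ of $n_v$) and $\lambda_{v,u}=\sum_{w=0}^{u-1}l^{\overline{E}_{v,w}}b_{v,w}$ (the $\mathbf l$-residue of index $u$ of $n_v$). -}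

module Defs where

open import Data.Nat as ℕ using (ℕ; zero; suc)
open import Data.Nat.Coprimality using (Coprime)
open import Data.Integer as ℤ using (ℤ; +_)
open import Data.Rational as ℚ using (ℚ)
open import Data.Product using (_×_)

ι : ℤ → ℚ
ι z = z ℚ./ 1

InZml : ℕ → ℕ → ℚ → Set
InZml m l q = Coprime (ℚ.↧ₙ q) m × Coprime (ℚ.↧ₙ q) l

Periodic : {A : Set} → ℕ → (ℤ → A) → Set
Periodic τ g = ∀ v → g (v ℤ.+ + τ) ≡ g v
  where open import Relation.Binary.PropositionalEquality using (_≡_)

sumℕ : ℕ → (ℕ → ℕ) → ℕ
sumℕ zero    g = 0
sumℕ (suc u) g = sumℕ u g ℕ.+ g u

sumℤ : ℕ → (ℕ → ℤ) → ℤ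
sumℤ zero    g = + 0
sumℤ (suc u) g = sumℤ u g ℤ.+ g u

Fsum : (ℤ → ℕ) → ℤ → ℕ → ℕ
Fsum f v u = sumℕ u (λ y → f (v ℤ.+ + y))

Ebar : (ℤ → ℕ) → ℤ → ℕ → ℕ
Ebar e v u = sumℕ u (λ y → e (v ℤ.- + 1 ℤ.- + y))

-- N_v = Σ_{w<τ} m^{F_{v,w}} l^{Ē_{v,τ-1-w}} a_{v+w}, where a_w := a_{w,i_w}
Nv : ℕ → ℕ → ℕ → (ℤ → ℕ) → (ℤ → ℕ) → (ℤ → ℤ) → ℤ → ℤ
Nv m l τ f e a v =
  sumℤ τ (λ w → + (m ℕ.^ Fsum f v w) ℤ.* + (l ℕ.^ Ebar e v (τ ℕ.∸ 1 ℕ.∸ w))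
                 ℤ.* a (v ℤ.+ + w))

mres : ℕ → (ℤ → ℕ) → (ℤ → ℕ → ℕ) → ℤ → ℕ → ℕ
mres m f d v u = sumℕ u (λ w → m ℕ.^ Fsum f v w ℕ.* d v w)

lres : ℕ → (ℤ → ℕ) → (ℤ → ℕ → ℕ) → ℤ → ℕ → ℕ
lres l e b v u = sumℕ u (λ w → l ℕ.^ Ebar e v w ℕ.* b v w)

module Submission where

-- All iterates n_{v+u} and all graded quotients k_{v,u}, j_{v,u} have the denominator D
-- of n_v, so everything can be read on numerators.  Put P = m^{F_{v,τ}}, L = l^{Ē_{v,τ}}, and let
-- N, K, J be the numerators of n_v, k_{v,τ}, j_{v,τ}.  Over one period:
--   (1) telescoping the recurrence gives         P·N = L·N − N_v·D;
--   (2) the radix expansions give                N = P·K + μ·D  and  N = L·J + λ·D, 0 ≤ λ < L;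
--   (3) a carry invariant along the orbit gives  N = L·K + c·D,  0 ≤ c < L,
--       which rests on the bound r_v < l^{e_v} for the carries.
-- As L ⊥ D the remainder in (2)/(3) is unique, so c = λ, and then
--   N_v·D = (L − P)·N = L·(P·K + μ·D) − P·(L·K + λ·D) = (L·μ − P·λ)·D.

open import Defs
open import Data.Nat as ℕ using (ℕ; zero; suc)
open import Data.Nat.Coprimality using (Coprime)
open import Data.Integer as ℤ using (ℤ; +_)
open import Data.Integer.Divisibility as ℤD using ()
open import Data.Rational as ℚ using (ℚ)
open import Data.Product using (_×_; Σ; ∃)
open import Relation.Nullary using (¬_)
open import Relation.Binary.PropositionalEquality using (_≡_)

import Data.Nat.Coprimality as ℕC
import Data.Nat.Divisibility as ℕD
import Data.Nat.Properties as ℕP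
import Data.Integer.Properties as ℤP
import Data.Integer.Coprimality as ℤC
import Data.Integer.Divisibility.Signed as ℤS
open import Data.Integer using (_+_; _*_; _-_; -_)
open import Data.Integer.Tactic.RingSolver using (solve-∀)
open import Data.Rational using (mkℚ)
import Data.Rational.Properties as ℚP
open import Data.Rational.Solver using (module +-*-Solver)
open import Data.Rational.Unnormalised as ℚᵘ using (mkℚᵘ; *≡*)
import Data.Rational.Unnormalised.Properties as ℚᵘP
open import Data.Product using (_,_; proj₁; proj₂; ∃-syntax)
open import Data.Empty using (⊥-elim)
open import Relation.Binary.Definitions using (tri<; tri≈; tri>)
open import Relation.Binary.PropositionalEquality

sumℕ-shift : ∀ u g → sumℕ (suc u) g ≡ g 0 ℕ.+ sumℕ u (λ y → g (suc y))
sumℕ-shift zero    g = sym (ℕP.+-identityʳ (g 0))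
sumℕ-shift (suc u) g = trans (cong (ℕ._+ g (suc u)) (sumℕ-shift u g)) (ℕP.+-assoc (g 0) _ _)

sumℕ-cong : ∀ u {g h} → (∀ y → g y ≡ h y) → sumℕ u g ≡ sumℕ u h
sumℕ-cong zero    g≡h = refl
sumℕ-cong (suc u) g≡h = cong₂ ℕ._+_ (sumℕ-cong u g≡h) (g≡h u)

sumℤ-cong : ∀ u {g h} → (∀ w → w ℕ.< u → g w ≡ h w) → sumℤ u g ≡ sumℤ u h
sumℤ-cong zero    g≡h = refl
sumℤ-cong (suc u) g≡h =
  cong₂ _+_ (sumℤ-cong u (λ w w<u → g≡h w (ℕP.m<n⇒m<1+n w<u))) (g≡h u (ℕP.n<1+n u))

sumℤ-scale : ∀ u c g → sumℤ u (λ w → c * g w) ≡ c * sumℤ u g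
sumℤ-scale zero    c g = sym (ℤP.*-zeroʳ c)
sumℤ-scale (suc u) c g = trans (cong (_+ c * g u) (sumℤ-scale u c g)) (sym (ℤP.*-distribˡ-+ c _ _))

∸-suc : ∀ {u w} → w ℕ.< u → u ℕ.∸ w ≡ suc (u ℕ.∸ 1 ℕ.∸ w)
∸-suc {suc u} (ℕ.s≤s w≤u) = ℕP.+-∸-assoc 1 w≤u

Ebar-shift : ∀ e x k → Ebar e (+ suc x) (suc k) ≡ e (+ x) ℕ.+ Ebar e (+ x) k
Ebar-shift e x k = trans (sumℕ-shift k _)
  (cong₂ ℕ._+_ (cong e (first (+ x))) (sumℕ-cong k (λ y → cong e (rest (+ x) (+ y)))))
  where
  first : ∀ i → (+ 1 + i) - + 1 - + 0 ≡ i
  first = solve-∀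
  rest : ∀ i y → (+ 1 + i) - + 1 - (+ 1 + y) ≡ i - + 1 - y
  rest = solve-∀

Ebar-periodic : ∀ {τ} e → Periodic τ e → ∀ x k → Ebar e (x + + τ) k ≡ Ebar e x k
Ebar-periodic {τ} e e-per x k = sumℕ-cong k (λ y → trans (cong e (shift x (+ τ) (+ y))) (e-per _))
  where
  shift : ∀ x t y → x + t - + 1 - y ≡ (x - + 1 - y) + t
  shift = solve-∀

coprime-* : ∀ {a b c} → Coprime a b → Coprime a c → Coprime a (b ℕ.* c)
coprime-* a⊥b a⊥c (i∣a , i∣bc) =
  a⊥c (i∣a , ℕC.coprime-divisor (λ (j∣i , j∣b) → a⊥b (ℕD.∣-trans j∣i i∣a , j∣b)) i∣bc)

coprime-^ : ∀ {a b} k → Coprime a b → Coprime a (b ℕ.^ k)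
coprime-^ zero    a⊥b = ℕC.sym (ℕC.1-coprimeTo _)
coprime-^ (suc k) a⊥b = coprime-* a⊥b (coprime-^ k a⊥b)

∣-power : ∀ l {e} → 1 ℕ.≤ e → l ℕD.∣ l ℕ.^ e
∣-power l {suc e} _ = ℕD.m∣m*n (l ℕ.^ e)

coprime-factor : ∀ {M D : ℕ} {Y Z : ℤ} → Coprime M D → + M * Y ≡ Z * + D → + M ℤS.∣ Z
coprime-factor {M} {D} {Y} {Z} M⊥D MY≡ZD =
  ℤS.∣ᵤ⇒∣ (ℤC.coprime-divisor (+ M) (+ D) Z M⊥D
    (ℤS.∣⇒∣ᵤ (ℤS.divides Y (trans (ℤP.*-comm (+ D) Z) (trans (sym MY≡ZD) (ℤP.*-comm (+ M) Y))))))

divides-third-factor : ∀ {E : ℕ} a b c → Coprime E ℤ.∣ a ∣ → Coprime E ℤ.∣ b ∣ →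
  + E ℤS.∣ a * (b * c) → E ℕD.∣ ℤ.∣ c ∣
divides-third-factor {E} a b c E⊥a E⊥b E∣abc =
  ℤC.coprime-divisor (+ E) b c E⊥b (ℤC.coprime-divisor (+ E) a (b * c) E⊥a (ℤS.∣⇒∣ᵤ E∣abc))

toℚᵘ-ι : ∀ z → ℚ.toℚᵘ (ι z) ℚᵘ.≃ mkℚᵘ z 0
toℚᵘ-ι z = ℚP.toℚᵘ-fromℚᵘ (mkℚᵘ z 0)

fraction-affine : ∀ γ δ p d →
  mkℚᵘ γ 0 ℚᵘ.* mkℚᵘ p d ℚᵘ.+ mkℚᵘ δ 0 ℚᵘ.≃ mkℚᵘ (γ * p + δ * + suc d) d
fraction-affine γ δ p d rewrite ℕP.+-identityʳ d | ℕP.*-identityʳ d = *≡* (identity γ δ p (+ suc d))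
  where
  identity : ∀ γ δ p D → (γ * p * + 1 + δ * D) * D ≡ (γ * p + δ * D) * D
  identity = solve-∀

toℚᵘ-affine : ∀ γ δ y →
  ℚ.toℚᵘ (ι γ ℚ.* y ℚ.+ ι δ) ℚᵘ.≃ mkℚᵘ (γ * ℚ.↥ y + δ * ℚ.↧ y) (ℚ.denominator-1 y)
toℚᵘ-affine γ δ y@(mkℚ p d _) =
  ℚᵘP.≃-trans (ℚP.toℚᵘ-homo-+ (ι γ ℚ.* y) (ι δ))
    (ℚᵘP.≃-trans (ℚᵘP.+-cong (ℚᵘP.≃-trans (ℚP.toℚᵘ-homo-* (ι γ) y) (ℚᵘP.*-congʳ (toℚᵘ-ι γ)))
                              (toℚᵘ-ι δ))
      (fraction-affine γ δ p d))

ι-* : ∀ a b → ι (a * b) ≡ ι a ℚ.* ι b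
ι-* a b = ℚP.toℚᵘ-injective (ℚᵘP.≃-trans (toℚᵘ-ι (a * b))
  (ℚᵘP.≃-sym (ℚᵘP.≃-trans (ℚP.toℚᵘ-homo-* (ι a) (ι b))
                           (ℚᵘP.*-cong (toℚᵘ-ι a) (toℚᵘ-ι b)))))

-- Cross-multiplied form of  α·(N/E) = γ·(p/D) + δ : when the numerators and the
-- integers α, γ are prime to the respective denominators, the denominators agree.
equal-denominators : ∀ (α N γ p δ : ℤ) (E D : ℕ) →
  Coprime E ℤ.∣ α ∣ → Coprime E ℤ.∣ N ∣ → Coprime D ℤ.∣ γ ∣ → Coprime D ℤ.∣ p ∣ →
  α * N * + D ≡ (γ * p + δ * + D) * + E → E ≡ D
equal-denominators α N γ p δ E D E⊥α E⊥N D⊥γ D⊥p cross = ℕD.∣-antisym E∣D D∣E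
  where
  E∣D : E ℕD.∣ D
  E∣D = divides-third-factor α N (+ D) E⊥α E⊥N
          (ℤS.divides (γ * p + δ * + D) (trans (sym (ℤP.*-assoc α N (+ D))) cross))
  rearranged : ∀ α N γ p δ D E → α * N * D ≡ (γ * p + δ * D) * E →
    γ * (p * E) ≡ (α * N - δ * E) * D
  rearranged α N γ p δ D E eq = begin
    γ * (p * E)                   ≡⟨ expand γ p δ D E ⟩
    (γ * p + δ * D) * E - δ * E * D ≡⟨ cong (_- δ * E * D) (sym eq) ⟩
    α * N * D - δ * E * D    ≡⟨ collect α N δ D E ⟩
    (α * N - δ * E) * D        ∎
    where
    open ≡-Reasoning
    expand : ∀ γ p δ D E → γ * (p * E) ≡ (γ * p + δ * D) * E - δ * E * D
    expand = solve-∀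
    collect : ∀ α N δ D E → α * N * D - δ * E * D ≡ (α * N - δ * E) * D
    collect = solve-∀
  D∣E : D ℕD.∣ E
  D∣E = divides-third-factor γ p (+ E) D⊥γ D⊥p
          (ℤS.divides (α * N - δ * + E) (rearranged α N γ p δ (+ D) (+ E) cross))

affine-numerators : ∀ α γ δ x y → Coprime (ℚ.↧ₙ x) ℤ.∣ α ∣ → Coprime (ℚ.↧ₙ y) ℤ.∣ γ ∣ →
  ι α ℚ.* x ≡ ι γ ℚ.* y ℚ.+ ι δ →
  ℚ.↧ₙ x ≡ ℚ.↧ₙ y × α * ℚ.↥ x ≡ γ * ℚ.↥ y + δ * ℚ.↧ x
affine-numerators α γ δ x@(mkℚ N e N⊥E) y@(mkℚ p d p⊥D) E⊥α D⊥γ αx≡γy+δ = E≡D , numerators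
  where
  crossᵘ : mkℚᵘ (α * N + + 0 * + suc e) e ℚᵘ.≃ mkℚᵘ (γ * p + δ * + suc d) d
  crossᵘ = ℚᵘP.≃-trans (ℚᵘP.≃-sym (toℚᵘ-affine α (+ 0) x))
             (ℚᵘP.≃-trans (ℚP.toℚᵘ-cong (trans (ℚP.+-identityʳ (ι α ℚ.* x)) αx≡γy+δ))
                          (toℚᵘ-affine γ δ y))
  cross : α * N * + suc d ≡ (γ * p + δ * + suc d) * + suc e
  cross with crossᵘ
  ... | *≡* eq = trans (cong (_* + suc d) (sym (drop-zero (α * N) (+ suc e)))) eq
    where
    drop-zero : ∀ a b → a + + 0 * b ≡ a
    drop-zero = solve-∀
  E≡D : suc e ≡ suc d
  E≡D = equal-denominators α N γ p δ (suc e) (suc d)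
          E⊥α (ℕC.sym (ℕC.recompute N⊥E)) D⊥γ (ℕC.sym (ℕC.recompute p⊥D)) cross
  numerators : α * N ≡ γ * p + δ * + suc e
  numerators = ℤP.*-cancelʳ-≡ _ _ (+ suc e)
    (subst (λ D → α * N * + D ≡ (γ * p + δ * + D) * + suc e) (sym E≡D) cross)

digit-numerators : ∀ γ δ x y → Coprime (ℚ.↧ₙ y) ℤ.∣ γ ∣ → x ≡ ι γ ℚ.* y ℚ.+ ι δ →
  ℚ.↧ₙ x ≡ ℚ.↧ₙ y × ℚ.↥ x ≡ γ * ℚ.↥ y + δ * ℚ.↧ x
digit-numerators γ δ x y D⊥γ x≡γy+δ
  with affine-numerators (+ 1) γ δ x y (ℕC.sym (ℕC.1-coprimeTo _)) D⊥γ (trans (ℚP.*-identityˡ x) x≡γy+δ)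
... | E≡D , numerators = E≡D , trans (sym (ℤP.*-identityˡ (ℚ.↥ x))) numerators

scaled-step : ∀ (M E s r : ℤ) (q n n' : ℚ) → n ≡ ι M ℚ.* q ℚ.+ ι s →
  n' ℚ.* ι M ≡ ι E ℚ.* (n ℚ.- ι s) ℚ.+ ι r ℚ.* ι M →
  ι M ℚ.* n' ≡ ι (E * M) ℚ.* q ℚ.+ ι (r * M)
scaled-step M E s r q n n' refl n'-eq = begin
  ι M ℚ.* n'                                              ≡⟨ ℚP.*-comm (ι M) n' ⟩
  n' ℚ.* ι M                                              ≡⟨ n'-eq ⟩
  ι E ℚ.* ((ι M ℚ.* q ℚ.+ ι s) ℚ.- ι s) ℚ.+ ι r ℚ.* ι M   ≡⟨ simplify (ι E) (ι M) q (ι s) (ι r) ⟩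
  (ι E ℚ.* ι M) ℚ.* q ℚ.+ ι r ℚ.* ι M
    ≡⟨ sym (cong₂ (λ x y → x ℚ.* q ℚ.+ y) (ι-* E M) (ι-* r M)) ⟩
  ι (E * M) ℚ.* q ℚ.+ ι (r * M)                       ∎
  where
  open ≡-Reasoning
  open +-*-Solver
  simplify : ∀ e m q s r → e ℚ.* ((m ℚ.* q ℚ.+ s) ℚ.- s) ℚ.+ r ℚ.* m ≡ (e ℚ.* m) ℚ.* q ℚ.+ r ℚ.* m
  simplify = solve 5 (λ e m q s r → e :* ((m :* q :+ s) :- s) :+ r :* m := (e :* m) :* q :+ r :* m) refl

step-numerators : ∀ (M E s r : ℕ) .{{_ : ℕ.NonZero M}} (q n n' : ℚ) →
  Coprime (ℚ.↧ₙ q) M → Coprime (ℚ.↧ₙ q) E → Coprime (ℚ.↧ₙ n') M →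
  n ≡ ι (+ M) ℚ.* q ℚ.+ ι (+ s) →
  n' ℚ.* ι (+ M) ≡ ι (+ E) ℚ.* (n ℚ.- ι (+ s)) ℚ.+ ι (+ r) ℚ.* ι (+ M) →
  ℚ.↧ₙ n' ≡ ℚ.↧ₙ n
  × ℚ.↥ n ≡ + M * ℚ.↥ q + + s * ℚ.↧ n
  × ℚ.↥ n' ≡ + E * ℚ.↥ q + + r * ℚ.↧ n
step-numerators M E s r q n n' q⊥M q⊥E n'⊥M n≡Mq+s n'-eq
  with digit-numerators (+ M) (+ s) n q q⊥M n≡Mq+s
     | affine-numerators (+ M) (+ E * + M) (+ r * + M) n' q n'⊥M q⊥EM
         (scaled-step (+ M) (+ E) (+ s) (+ r) q n n' n≡Mq+s n'-eq)
  where
  q⊥EM : Coprime (ℚ.↧ₙ q) ℤ.∣ + E * + M ∣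
  q⊥EM = subst (Coprime (ℚ.↧ₙ q)) (sym (ℤP.abs-* (+ E) (+ M))) (coprime-* q⊥E q⊥M)
... | den-n≡den-q , n̂≡ | den-n'≡den-q , Mn̂'≡ = den-n'≡den-n , n̂≡ , n̂'≡
  where
  regroup : ∀ E M Q r D → (E * M) * Q + (r * M) * D ≡ M * (E * Q + r * D)
  regroup = solve-∀
  den-n'≡den-n : ℚ.↧ₙ n' ≡ ℚ.↧ₙ n
  den-n'≡den-n = trans den-n'≡den-q (sym den-n≡den-q)
  n̂'≡ : ℚ.↥ n' ≡ + E * ℚ.↥ q + + r * ℚ.↧ n
  n̂'≡ = ℤP.*-cancelˡ-≡ (+ M) _ _ (trans Mn̂'≡
          (trans (regroup (+ E) (+ M) (ℚ.↥ q) (+ r) (ℚ.↧ n'))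
                 (cong (λ D → + M * (+ E * ℚ.↥ q + + r * + D)) den-n'≡den-n)))

quotient-in-range : ∀ {X s M G : ℕ} (t : ℤ) → s ℕ.< M → X ℕ.< G ℕ.* M →
  + X - + s ≡ t * + M → ∃[ c ] t ≡ + c × c ℕ.< G
quotient-in-range {X} {s} {M} {G} (+ c) s<M X<GM X-s≡cM =
  c , refl , ℕP.*-cancelʳ-< M c G (ℕP.≤-<-trans cM≤X X<GM)
  where
  open ≡-Reasoning
  X≡cM+s : + X ≡ + (c ℕ.* M ℕ.+ s)
  X≡cM+s = begin
    + X                    ≡⟨ add-back (+ X) (+ s) ⟩
    (+ X - + s) + + s  ≡⟨ cong (_+ + s) X-s≡cM ⟩
    + c * + M + + s    ≡⟨ cong (_+ + s) (sym (ℤP.pos-* c M)) ⟩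
    + (c ℕ.* M) + + s    ≡⟨ sym (ℤP.pos-+ (c ℕ.* M) s) ⟩
    + (c ℕ.* M ℕ.+ s)      ∎
    where
    add-back : ∀ x y → x ≡ (x - y) + y
    add-back = solve-∀
  cM≤X : c ℕ.* M ℕ.≤ X
  cM≤X = ℕP.≤-trans (ℕP.m≤m+n (c ℕ.* M) s) (ℕP.≤-reflexive (sym (ℤP.+-injective X≡cM+s)))
quotient-in-range {X} {s} {M} ℤ.-[1+ c ] s<M X<GM X-s≡-cM = ⊥-elim (ℕP.<⇒≱ s<M M≤s)
  where
  s≡X+cM : + s ≡ + (X ℕ.+ suc c ℕ.* M)
  s≡X+cM = begin
    + s                                      ≡⟨ take-back (+ X) (+ s) ⟩
    + X - (+ X - + s)                    ≡⟨ cong (λ z → + X - z) X-s≡-cM ⟩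
    + X - (- (+ suc c) * + M)          ≡⟨ negate (+ X) (+ suc c) (+ M) ⟩
    + X + + suc c * + M                  ≡⟨ cong (λ z → + X + z) (sym (ℤP.pos-* (suc c) M)) ⟩
    + X + + (suc c ℕ.* M)                  ≡⟨ sym (ℤP.pos-+ X (suc c ℕ.* M)) ⟩
    + (X ℕ.+ suc c ℕ.* M)                    ∎
    where
    open ≡-Reasoning
    take-back : ∀ x y → y ≡ x - (x - y)
    take-back = solve-∀
    negate : ∀ x c m → x - (- c * m) ≡ x + c * m
    negate = solve-∀
  M≤s : M ℕ.≤ s
  M≤s = begin
    M                    ≤⟨ ℕP.m≤m+n M (c ℕ.* M) ⟩
    suc c ℕ.* M          ≤⟨ ℕP.m≤n+m (suc c ℕ.* M) X ⟩
    X ℕ.+ suc c ℕ.* M    ≡⟨ sym (ℤP.+-injective s≡X+cM) ⟩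
    s                    ∎
    where open ℕP.≤-Reasoning

unique-remainder : ∀ {L D c c' : ℕ} (K K' : ℤ) → Coprime L D → c ℕ.< L → c' ℕ.< L →
  + L * K + + c * + D ≡ + L * K' + + c' * + D → c ≡ c'
unique-remainder {L} {D} {c} {c'} K K' L⊥D c<L c'<L eq =
  sym (ℤP.+-injective (ℤP.i-j≡0⇒i≡j (+ c') (+ c) c'-c≡0))
  where
  L[K-K']≡[c'-c]D : + L * (K - K') ≡ (+ c' - + c) * + D
  L[K-K']≡[c'-c]D = begin
    + L * (K - K')                                          ≡⟨ expand (+ L) K K' (+ c) (+ D) ⟩
    (+ L * K + + c * + D) - (+ L * K' + + c * + D) ≡⟨ cong (_- (+ L * K' + + c * + D)) eq ⟩
    (+ L * K' + + c' * + D) - (+ L * K' + + c * + D) ≡⟨ collect (+ L) K' (+ c) (+ c') (+ D) ⟩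
    (+ c' - + c) * + D                                      ∎
    where
    open ≡-Reasoning
    expand : ∀ L K K' c D → L * (K - K') ≡ (L * K + c * D) - (L * K' + c * D)
    expand = solve-∀
    collect : ∀ L K' c c' D → (L * K' + c' * D) - (L * K' + c * D) ≡ (c' - c) * D
    collect = solve-∀
  c'<1*L : c' ℕ.< 1 ℕ.* L
  c'<1*L = subst (c' ℕ.<_) (sym (ℕP.*-identityˡ L)) c'<L
  c'-c≡0 : + c' - + c ≡ + 0
  c'-c≡0 with coprime-factor L⊥D L[K-K']≡[c'-c]D
  ... | ℤS.divides t c'-c≡tL with quotient-in-range {G = 1} t c<L c'<1*L c'-c≡tL
  ... | t' , refl , t'<1 = trans c'-c≡tL (cong (λ z → + z * + L) (ℕP.n<1⇒n≡0 t'<1))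

-- For a carry  r > L  the relation  L·s = M·r + a  forces a far below −(M + L).
large-carry : ∀ {L M s r : ℕ} → s ℕ.< M → L ℕ.< r → L ℕ.* s ℕ.+ L ℕ.+ M ℕ.≤ M ℕ.* r
large-carry {L} {M} {s} {r} s<M L<r = begin
  L ℕ.* s ℕ.+ L ℕ.+ M  ≡⟨ cong (ℕ._+ M) (trans (ℕP.+-comm (L ℕ.* s) L) (sym (ℕP.*-suc L s))) ⟩
  L ℕ.* suc s ℕ.+ M    ≤⟨ ℕP.+-monoˡ-≤ M (ℕP.*-monoʳ-≤ L s<M) ⟩
  L ℕ.* M ℕ.+ M        ≡⟨ trans (ℕP.+-comm (L ℕ.* M) M) (cong (M ℕ.+_) (ℕP.*-comm L M)) ⟩
  M ℕ.+ M ℕ.* L        ≡⟨ sym (ℕP.*-suc M L) ⟩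
  M ℕ.* suc L          ≤⟨ ℕP.*-monoʳ-≤ M L<r ⟩
  M ℕ.* r              ∎
  where open ℕP.≤-Reasoning

carry-bound : ∀ {l L M s r : ℕ} (a : ℤ) → l ℕD.∣ L → s ℕ.< M → ¬ (+ l ℤD.∣ a) →
  + L * + s ≡ + M * + r + a → ℤ.∣ a ∣ ℕ.< M ℕ.⊔ L → r ℕ.< L
carry-bound {L = L} {M} {s} {r} a l∣L s<M l∤a Ls≡Mr+a |a|<M⊔L with ℕP.<-cmp r L
... | tri< r<L _ _ = r<L
... | tri≈ _ refl _ = ⊥-elim (l∤a (ℕD.∣-trans l∣L (ℤS.∣⇒∣ᵤ (ℤS.divides (+ s - + M) a≡[s-M]L))))
  where
  a≡[s-M]L : a ≡ (+ s - + M) * + L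
  a≡[s-M]L = begin
    a                                  ≡⟨ cancel (+ M * + L) a ⟩
    (+ M * + L + a) - + M * + L ≡⟨ cong (_- + M * + L) (sym Ls≡Mr+a) ⟩
    + L * + s - + M * + L         ≡⟨ factor (+ L) (+ s) (+ M) ⟩
    (+ s - + M) * + L               ∎
    where
    open ≡-Reasoning
    cancel : ∀ b a → a ≡ (b + a) - b
    cancel = solve-∀
    factor : ∀ L s M → L * s - M * L ≡ (s - M) * L
    factor = solve-∀
... | tri> _ _ L<r = refute a Ls≡Mr+a |a|<M⊔L
  where
  Ls+L+M≤Mr = large-carry s<M L<r
  refute : ∀ a → + L * + s ≡ + M * + r + a → ℤ.∣ a ∣ ℕ.< M ℕ.⊔ L → r ℕ.< L
  refute (+ x) eq _ = ⊥-elim (ℕP.<-irrefl refl (begin-strict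
    L ℕ.* s              ≤⟨ ℕP.m≤m+n (L ℕ.* s) L ⟩
    L ℕ.* s ℕ.+ L        <⟨ ℕP.m<m+n (L ℕ.* s ℕ.+ L) (ℕP.≤-<-trans ℕ.z≤n s<M) ⟩
    L ℕ.* s ℕ.+ L ℕ.+ M  ≤⟨ Ls+L+M≤Mr ⟩
    M ℕ.* r              ≤⟨ ℕP.m≤m+n (M ℕ.* r) x ⟩
    M ℕ.* r ℕ.+ x        ≡⟨ ℤP.+-injective Mr+x≡Ls ⟩
    L ℕ.* s              ∎))
    where
    open ℕP.≤-Reasoning
    Mr+x≡Ls : + (M ℕ.* r ℕ.+ x) ≡ + (L ℕ.* s)
    Mr+x≡Ls = sym (trans (ℤP.pos-* L s) (trans eq
                (trans (cong (_+ + x) (sym (ℤP.pos-* M r))) (sym (ℤP.pos-+ (M ℕ.* r) x)))))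
  refute ℤ.-[1+ x ] eq |a|<M⊔L = ⊥-elim (ℕP.<⇒≱ |a|<M⊔L M⊔L≤1+x)
    where
    Ls+x≡Mr : + (L ℕ.* s ℕ.+ suc x) ≡ + (M ℕ.* r)
    Ls+x≡Mr = begin
      + (L ℕ.* s ℕ.+ suc x)                       ≡⟨ ℤP.pos-+ (L ℕ.* s) (suc x) ⟩
      + (L ℕ.* s) + + suc x                     ≡⟨ cong (_+ + suc x) (trans (ℤP.pos-* L s) eq) ⟩
      + M * + r + - (+ suc x) + + suc x   ≡⟨ cancel (+ M * + r) (+ suc x) ⟩
      + M * + r                                 ≡⟨ sym (ℤP.pos-* M r) ⟩
      + (M ℕ.* r)                                 ∎
      where
      open ≡-Reasoning
      cancel : ∀ b c → b + - c + c ≡ b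
      cancel = solve-∀
    M⊔L≤1+x : M ℕ.⊔ L ℕ.≤ suc x
    M⊔L≤1+x = ℕP.≤-trans (ℕP.m⊔n≤m+n M L) (ℕP.+-cancelˡ-≤ (L ℕ.* s) (M ℕ.+ L) (suc x) (begin
      L ℕ.* s ℕ.+ (M ℕ.+ L)  ≡⟨ cong (L ℕ.* s ℕ.+_) (ℕP.+-comm M L) ⟩
      L ℕ.* s ℕ.+ (L ℕ.+ M)  ≡⟨ sym (ℕP.+-assoc (L ℕ.* s) L M) ⟩
      L ℕ.* s ℕ.+ L ℕ.+ M    ≤⟨ Ls+L+M≤Mr ⟩
      M ℕ.* r                ≡⟨ sym (ℤP.+-injective Ls+x≡Mr) ⟩
      L ℕ.* s ℕ.+ suc x      ∎))
      where open ℕP.≤-Reasoning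

pos-+-* : ∀ a b c → + (a ℕ.+ b ℕ.* c) ≡ + a + + b * + c
pos-+-* a b c = trans (ℤP.pos-+ a (b ℕ.* c)) (cong (λ z → + a + z) (ℤP.pos-* b c))

mixed-radix-bound : ∀ {R P δ B : ℕ} → R ℕ.< P → δ ℕ.< B → R ℕ.+ P ℕ.* δ ℕ.< P ℕ.* B
mixed-radix-bound {R} {P} {δ} {B} R<P δ<B = begin-strict
  R ℕ.+ P ℕ.* δ    <⟨ ℕP.+-monoˡ-< (P ℕ.* δ) R<P ⟩
  P ℕ.+ P ℕ.* δ    ≡⟨ sym (ℕP.*-suc P δ) ⟩
  P ℕ.* suc δ      ≤⟨ ℕP.*-monoʳ-≤ P δ<B ⟩
  P ℕ.* B          ∎
  where open ℕP.≤-Reasoning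

expansion-step : ∀ (P B R δ : ℕ) (X K K' D : ℤ) → X ≡ + P * K + + R * D →
  K ≡ + B * K' + + δ * D → X ≡ + (P ℕ.* B) * K' + + (R ℕ.+ P ℕ.* δ) * D
expansion-step P B R δ X K K' D refl refl = begin
  + P * (+ B * K' + + δ * D) + + R * D     ≡⟨ regroup (+ P) (+ B) K' (+ δ) D (+ R) ⟩
  (+ P * + B) * K' + (+ R + + P * + δ) * D ≡⟨ cong₂ (λ x y → x * K' + y * D) (sym (ℤP.pos-* P B)) (sym (pos-+-* R P δ)) ⟩
  + (P ℕ.* B) * K' + + (R ℕ.+ P ℕ.* δ) * D ∎
  where
  open ≡-Reasoning
  regroup : ∀ P B K' δ D R → P * (B * K' + δ * D) + R * D ≡ (P * B) * K' + (R + P * δ) * D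
  regroup = solve-∀

numerator-recurrence : ∀ (M E s r a Q N N' D : ℤ) → E * s ≡ M * r + a →
  N ≡ M * Q + s * D → N' ≡ E * Q + r * D → M * N' ≡ E * N - a * D
numerator-recurrence M E s r a Q N N' D Es≡Mr+a refl refl = begin
  M * (E * Q + r * D)                                ≡⟨ expand M E s r Q D ⟩
  E * (M * Q + s * D) - (E * s - M * r) * D ≡⟨ cong (λ z → E * (M * Q + s * D) - (z - M * r) * D) Es≡Mr+a ⟩
  E * (M * Q + s * D) - (M * r + a - M * r) * D ≡⟨ cancel (E * (M * Q + s * D)) (M * r) a D ⟩
  E * (M * Q + s * D) - a * D                     ∎
  where
  open ≡-Reasoning
  expand : ∀ M E s r Q D → M * (E * Q + r * D) ≡ E * (M * Q + s * D) - (E * s - M * r) * D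
  expand = solve-∀
  cancel : ∀ X b a D → X - (b + a - b) * D ≡ X - a * D
  cancel = solve-∀

telescope-step : ∀ (P M N' N E L N₀ S a D : ℤ) → M * N' ≡ E * N - a * D →
  P * N ≡ L * N₀ - S * D → (P * M) * N' ≡ (E * L) * N₀ - (E * S + P * a) * D
telescope-step P M N' N E L N₀ S a D step tele = begin
  (P * M) * N'                               ≡⟨ ℤP.*-assoc P M N' ⟩
  P * (M * N')                               ≡⟨ cong (P *_) step ⟩
  P * (E * N - a * D)                    ≡⟨ distribute P E N a D ⟩
  E * (P * N) - P * a * D              ≡⟨ cong (λ z → E * z - P * a * D) tele ⟩
  E * (L * N₀ - S * D) - P * a * D ≡⟨ collect E L N₀ S D P a ⟩
  (E * L) * N₀ - (E * S + P * a) * D ∎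
  where
  open ≡-Reasoning
  distribute : ∀ P E N a D → P * (E * N - a * D) ≡ E * (P * N) - P * a * D
  distribute = solve-∀
  collect : ∀ E L N₀ S D P a → E * (L * N₀ - S * D) - P * a * D ≡ (E * L) * N₀ - (E * S + P * a) * D
  collect = solve-∀

carry-step : ∀ {M L E D s d c r : ℕ} {Q K K' N N' : ℤ} → Coprime M D →
  s ℕ.< M → d ℕ.< M → c ℕ.< L → r ℕ.< E →
  N ≡ + M * Q + + s * + D → N' ≡ + E * Q + + r * + D →
  K ≡ + M * K' + + d * + D → N ≡ + L * K + + c * + D →
  ∃[ c' ] c' ℕ.< E ℕ.* L × N' ≡ + (E ℕ.* L) * K' + + c' * + D
carry-step {M} {L} {E} {D} {s} {d} {c} {r} {Q} {K} {K'} {N' = N'} M⊥D s<M d<M c<L r<E N≡ N'≡ K≡ N≡LK+cD =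
  extend carry
  where
  instance
    M≢0 : ℕ.NonZero M
    M≢0 = ℕ.>-nonZero (ℕP.m<n⇒0<n s<M)
  X : ℕ
  X = c ℕ.+ L ℕ.* d
  M[Q-LK']≡[X-s]D : + M * (Q - + L * K') ≡ (+ X - + s) * + D
  M[Q-LK']≡[X-s]D = begin
    + M * (Q - + L * K')        ≡⟨ isolate (+ M) Q (+ L) K' (+ s) (+ D) (+ c) (+ d) MQ+sD≡L[MK'+dD]+cD ⟩
    (+ c + + L * + d - + s) * + D ≡⟨ cong (λ z → (z - + s) * + D) (sym (pos-+-* c L d)) ⟩
    (+ X - + s) * + D           ∎
    where
    open ≡-Reasoning
    MQ+sD≡L[MK'+dD]+cD : + M * Q + + s * + D ≡ + L * (+ M * K' + + d * + D) + + c * + D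
    MQ+sD≡L[MK'+dD]+cD = trans (sym N≡) (trans N≡LK+cD (cong (λ z → + L * z + + c * + D) K≡))
    isolate : ∀ M Q L K' s D c d → M * Q + s * D ≡ L * (M * K' + d * D) + c * D →
      M * (Q - L * K') ≡ (c + L * d - s) * D
    isolate M Q L K' s D c d eq = begin
      M * (Q - L * K')                                      ≡⟨ expand M Q L K' s D ⟩
      (M * Q + s * D) - L * (M * K') - s * D                ≡⟨ cong (λ z → z - L * (M * K') - s * D) eq ⟩
      (L * (M * K' + d * D) + c * D) - L * (M * K') - s * D ≡⟨ collect L M K' d D c s ⟩
      (c + L * d - s) * D                                   ∎
      where
      expand : ∀ M Q L K' s D → M * (Q - L * K') ≡ (M * Q + s * D) - L * (M * K') - s * D
      expand = solve-∀
      collect : ∀ L M K' d D c s → (L * (M * K' + d * D) + c * D) - L * (M * K') - s * D ≡ (c + L * d - s) * D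
      collect = solve-∀
  -- X − s is a multiple c″·M of M with 0 ≤ c″ < L, hence  Q = L·K' + c″·D.
  carry : ∃[ c″ ] c″ ℕ.< L × Q ≡ + L * K' + + c″ * + D
  carry with coprime-factor M⊥D M[Q-LK']≡[X-s]D
  ... | ℤS.divides t X-s≡tM with quotient-in-range {G = L} t s<M (mixed-radix-bound c<L d<M) X-s≡tM
  ... | c″ , refl , c″<L = c″ , c″<L , (begin
    Q                                     ≡⟨ split Q (+ L * K') ⟩
    + L * K' + (Q - + L * K')     ≡⟨ cong (λ z → + L * K' + z) Q-LK'≡c″D ⟩
    + L * K' + + c″ * + D           ∎)
    where
    open ≡-Reasoning
    split : ∀ Q P → Q ≡ P + (Q - P)
    split = solve-∀
    reorder : ∀ c M D → c * M * D ≡ M * (c * D)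
    reorder = solve-∀
    Q-LK'≡c″D : Q - + L * K' ≡ + c″ * + D
    Q-LK'≡c″D = ℤP.*-cancelˡ-≡ (+ M) _ _
      (trans M[Q-LK']≡[X-s]D (trans (cong (_* + D) X-s≡tM) (reorder (+ c″) (+ M) (+ D))))
  extend : (∃[ c″ ] c″ ℕ.< L × Q ≡ + L * K' + + c″ * + D) →
    ∃[ c' ] c' ℕ.< E ℕ.* L × N' ≡ + (E ℕ.* L) * K' + + c' * + D
  extend (c″ , c″<L , Q≡LK'+c″D) =
    r ℕ.+ E ℕ.* c″ , mixed-radix-bound r<E c″<L , expansion-step E L r c″ N' Q K' (+ D) N'≡ Q≡LK'+c″D

residue-identity : ∀ {L P D μ λ' : ℕ} .{{_ : ℕ.NonZero D}} (N K J S : ℤ) → Coprime L D → λ' ℕ.< L →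
  + P * N ≡ + L * N - S * + D →
  N ≡ + P * K + + μ * + D →
  N ≡ + L * J + + λ' * + D →
  (∃[ c ] c ℕ.< L × N ≡ + L * K + + c * + D) →
  S ≡ + L * + μ - + P * + λ'
residue-identity {L} {P} {D} {μ} {λ'} N K J S L⊥D λ<L telescoped m-expansion l-expansion (c , c<L , carried) =
  ℤP.*-cancelʳ-≡ S (+ L * + μ - + P * + λ') (+ D) (begin
    S * + D                                                 ≡⟨ isolate S (+ D) (+ L) (+ P) N telescoped ⟩
    + L * N - + P * N                                   ≡⟨ cong₂ (λ x y → + L * x - + P * y) m-expansion carried′ ⟩
    + L * (+ P * K + + μ * + D) - + P * (+ L * K + + λ' * + D) ≡⟨ collect (+ L) (+ P) K (+ μ) (+ D) (+ λ') ⟩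
    (+ L * + μ - + P * + λ') * + D                     ∎)
  where
  open ≡-Reasoning
  c≡λ' : c ≡ λ'
  c≡λ' = unique-remainder K J L⊥D c<L λ<L (trans (sym carried) l-expansion)
  carried′ : N ≡ + L * K + + λ' * + D
  carried′ = subst (λ z → N ≡ + L * K + + z * + D) c≡λ' carried
  isolate : ∀ S D L P N → P * N ≡ L * N - S * D → S * D ≡ L * N - P * N
  isolate S D L P N eq = begin
    S * D                            ≡⟨ unfold S D L N ⟩
    L * N - (L * N - S * D)  ≡⟨ cong (λ z → L * N - z) (sym eq) ⟩
    L * N - P * N                ∎
    where
    unfold : ∀ S D L N → S * D ≡ L * N - (L * N - S * D)
    unfold = solve-∀
  collect : ∀ L P K μ D λ' → L * (P * K + μ * D) - P * (L * K + λ' * D) ≡ (L * μ - P * λ') * D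
  collect = solve-∀

radix-value : ℕ → (ℕ → ℕ) → (ℕ → ℕ) → ℕ → ℕ
radix-value b g δ u = sumℕ u (λ w → b ℕ.^ sumℕ w g ℕ.* δ w)

radix-value-bound : ∀ b g δ → (∀ w → δ w ℕ.< b ℕ.^ g w) → ∀ u → radix-value b g δ u ℕ.< b ℕ.^ sumℕ u g
radix-value-bound b g δ δ<b^g zero    = ℕ.s≤s ℕ.z≤n
radix-value-bound b g δ δ<b^g (suc u) =
  subst (radix-value b g δ (suc u) ℕ.<_) (sym (ℕP.^-distribˡ-+-* b (sumℕ u g) (g u)))
    (mixed-radix-bound (radix-value-bound b g δ δ<b^g u) (δ<b^g u))

radix-expansion : ∀ b g δ (y : ℚ) (x : ℕ → ℚ) → x 0 ≡ y →
  (∀ w → x w ≡ ι (+ (b ℕ.^ g w)) ℚ.* x (suc w) ℚ.+ ι (+ δ w)) →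
  (∀ w → Coprime (ℚ.↧ₙ (x (suc w))) b) →
  ∀ u → ℚ.↧ₙ (x u) ≡ ℚ.↧ₙ y
      × ℚ.↥ y ≡ + (b ℕ.^ sumℕ u g) * ℚ.↥ (x u) + + radix-value b g δ u * ℚ.↧ y
radix-expansion b g δ y x refl step x⊥b zero = refl , trivial (ℚ.↥ (x 0)) (ℚ.↧ (x 0))
  where
  trivial : ∀ X D → X ≡ + 1 * X + + 0 * D
  trivial = solve-∀
radix-expansion b g δ y x refl step x⊥b (suc u)
  with radix-expansion b g δ y x refl step x⊥b u
     | digit-numerators (+ (b ℕ.^ g u)) (+ δ u) (x u) (x (suc u)) (coprime-^ (g u) (x⊥b u)) (step u)
... | den-u , y≡ | den-u≡den-u+1 , x̂u≡ =
  trans (sym den-u≡den-u+1) den-u ,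
  subst (λ P → ℚ.↥ y ≡ + P * X' + + radix-value b g δ (suc u) * ℚ.↧ y)
    (sym (ℕP.^-distribˡ-+-* b (sumℕ u g) (g u)))
    (expansion-step (b ℕ.^ sumℕ u g) (b ℕ.^ g u) (radix-value b g δ u) (δ u) (ℚ.↥ y) (ℚ.↥ (x u)) X' (ℚ.↧ y)
      y≡ (subst (λ D → ℚ.↥ (x u) ≡ + (b ℕ.^ g u) * X' + + δ u * + D) den-u x̂u≡))
  where
  X' : ℤ
  X' = ℚ.↥ (x (suc u))

module Orbit
  (m l : ℕ) .{{_ : ℕ.NonZero m}} .{{_ : ℕ.NonZero l}}
  (f e s r : ℤ → ℕ) (a : ℤ → ℤ) (n : ℤ → ℚ) (k : ℤ → ℕ → ℚ) (d : ℤ → ℕ → ℕ)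
  (n∈Zml : ∀ w → InZml m l (n w))
  (n-digit : ∀ w → Σ ℚ λ q → InZml m l q × n w ≡ ι (+ (m ℕ.^ f w)) ℚ.* q ℚ.+ ι (+ s w))
  (n-step : ∀ w → n (w + + 1) ℚ.* ι (+ (m ℕ.^ f w))
                  ≡ ι (+ (l ℕ.^ e w)) ℚ.* (n w ℚ.- ι (+ s w)) ℚ.+ ι (+ r w) ℚ.* ι (+ (m ℕ.^ f w)))
  (carry-relation : ∀ w → + (l ℕ.^ e w) * + s w ≡ + (m ℕ.^ f w) * + r w + a w)
  (s<M : ∀ w → s w ℕ.< m ℕ.^ f w) (r<E : ∀ w → r w ℕ.< l ℕ.^ e w)
  (k-start : ∀ w → k w 0 ≡ n w)
  (k-step : ∀ w u → k w u ≡ ι (+ (m ℕ.^ f (w + + u))) ℚ.* k w (suc u) ℚ.+ ι (+ d w u)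
                    × d w u ℕ.< m ℕ.^ f (w + + u) × InZml m l (k w (suc u)))
  (v : ℕ) where

  idx : ℕ → ℤ
  idx u = + (v ℕ.+ u)

  M E : ℕ → ℕ
  M u = m ℕ.^ f (idx u)
  E u = l ℕ.^ e (idx u)

  D : ℕ
  D = ℚ.↧ₙ (n (+ v))

  N₀ : ℤ
  N₀ = ℚ.↥ (n (+ v))

  N K : ℕ → ℤ
  N u = ℚ.↥ (n (idx u))
  K u = ℚ.↥ (k (+ v) u)

  -- P_u = m^{F_{v,u}} = M_0⋯M_{u-1}  and  Λ_u = l^{Ē_{v+u,u}} = E_0⋯E_{u-1}
  P Λ : ℕ → ℕ
  P u = m ℕ.^ Fsum f (+ v) u
  Λ u = l ℕ.^ Ebar e (idx u) u

  -- the partial sum of N_v after u steps:  Σ_{w<u} P_w · E_{w+1}⋯E_{u-1} · a_{v+w}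
  S : ℕ → ℤ
  S u = sumℤ u (λ w → + P w * + (l ℕ.^ Ebar e (idx u) (u ℕ.∸ 1 ℕ.∸ w)) * a (+ v + + w))

  n-start : n (idx 0) ≡ n (+ v)
  n-start = cong (λ x → n (+ x)) (ℕP.+-identityʳ v)

  n-next : ∀ u → n (idx u + + 1) ≡ n (idx (suc u))
  n-next u = cong (λ x → n (+ x)) (trans (ℕP.+-comm (v ℕ.+ u) 1) (sym (ℕP.+-suc v u)))

  Ebar-next : ∀ u j → Ebar e (idx (suc u)) (suc j) ≡ e (idx u) ℕ.+ Ebar e (idx u) j
  Ebar-next u j rewrite ℕP.+-suc v u = Ebar-shift e (v ℕ.+ u) j

  orbit-map : ∀ u → n (idx (suc u)) ℚ.* ι (+ M u)
                    ≡ ι (+ E u) ℚ.* (n (idx u) ℚ.- ι (+ s (idx u))) ℚ.+ ι (+ r (idx u)) ℚ.* ι (+ M u)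
  orbit-map u = subst (λ n' → n' ℚ.* ι (+ M u) ≡ image) (n-next u) (n-step (idx u))
    where
    image : ℚ
    image = ι (+ E u) ℚ.* (n (idx u) ℚ.- ι (+ s (idx u))) ℚ.+ ι (+ r (idx u)) ℚ.* ι (+ M u)

  orbit-step : ∀ u → Σ ℤ λ Q → ℚ.↧ₙ (n (idx (suc u))) ≡ ℚ.↧ₙ (n (idx u))
    × N u ≡ + M u * Q + + s (idx u) * ℚ.↧ (n (idx u))
    × N (suc u) ≡ + E u * Q + + r (idx u) * ℚ.↧ (n (idx u))
  orbit-step u with n-digit (idx u)
  ... | q , (q⊥m , q⊥l) , n≡Mq+s = ℚ.↥ q ,
    step-numerators (M u) (E u) (s (idx u)) (r (idx u)) {{ℕP.m^n≢0 m (f (idx u))}} q (n (idx u)) (n (idx (suc u)))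
      (coprime-^ (f (idx u)) q⊥m) (coprime-^ (e (idx u)) q⊥l)
      (coprime-^ (f (idx u)) (proj₁ (n∈Zml (idx (suc u))))) n≡Mq+s
      (orbit-map u)

  orbit-denominator : ∀ u → ℚ.↧ₙ (n (idx u)) ≡ D
  orbit-denominator zero    = cong ℚ.↧ₙ_ n-start
  orbit-denominator (suc u) = trans (proj₁ (proj₂ (orbit-step u))) (orbit-denominator u)

  orbit-numerators : ∀ u → Σ ℤ λ Q → N u ≡ + M u * Q + + s (idx u) * + D
                                   × N (suc u) ≡ + E u * Q + + r (idx u) * + D
  orbit-numerators u with orbit-step u
  ... | Q , _ , N≡ , N'≡ rewrite orbit-denominator u = Q , N≡ , N'≡

  numerator-step : ∀ u → + M u * N (suc u) ≡ + E u * N u - a (idx u) * + D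
  numerator-step u with orbit-numerators u
  ... | Q , N≡ , N'≡ = numerator-recurrence (+ M u) (+ E u) (+ s (idx u)) (+ r (idx u)) (a (idx u))
                         Q (N u) (N (suc u)) (+ D) (carry-relation (idx u)) N≡ N'≡

  Λ-step : ∀ u → E u ℕ.* Λ u ≡ Λ (suc u)
  Λ-step u = sym (trans (cong (l ℕ.^_) (Ebar-next u u)) (ℕP.^-distribˡ-+-* l (e (idx u)) (Ebar e (idx u) u)))

  -- S_{u+1} = E_u·S_u + P_u·a_{v+u}: each earlier summand picks up the factor E_u
  S-step : ∀ u → S (suc u) ≡ + E u * S u + + P u * a (idx u)
  S-step u = cong₂ _+_ (trans (sumℤ-cong u earlier) (sumℤ-scale u (+ E u) _)) last
    where
    term : ℕ → ℕ → ℤ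
    term t w = + P w * + (l ℕ.^ Ebar e (idx t) (t ℕ.∸ 1 ℕ.∸ w)) * a (+ v + + w)
    reorder : ∀ P E L a → P * (E * L) * a ≡ E * (P * L * a)
    reorder = solve-∀
    earlier : ∀ w → w ℕ.< u → term (suc u) w ≡ + E u * term u w
    earlier w w<u = begin
      + P w * + (l ℕ.^ Ebar e (idx (suc u)) (u ℕ.∸ w)) * a (+ v + + w)
        ≡⟨ cong (λ j → + P w * + (l ℕ.^ Ebar e (idx (suc u)) j) * a (+ v + + w)) (∸-suc w<u) ⟩
      + P w * + (l ℕ.^ Ebar e (idx (suc u)) (suc (u ℕ.∸ 1 ℕ.∸ w))) * a (+ v + + w)
        ≡⟨ cong (λ x → + P w * x * a (+ v + + w)) (trans (cong (λ j → + (l ℕ.^ j)) (Ebar-next u (u ℕ.∸ 1 ℕ.∸ w)))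
             (trans (cong +_ (ℕP.^-distribˡ-+-* l (e (idx u)) _)) (ℤP.pos-* (E u) _))) ⟩
      + P w * (+ E u * + (l ℕ.^ Ebar e (idx u) (u ℕ.∸ 1 ℕ.∸ w))) * a (+ v + + w)
        ≡⟨ reorder (+ P w) (+ E u) _ (a (+ v + + w)) ⟩
      + E u * term u w ∎
      where open ≡-Reasoning
    last : term (suc u) u ≡ + P u * a (idx u)
    last = trans (cong (λ j → + P u * + (l ℕ.^ Ebar e (idx (suc u)) j) * a (idx u)) (ℕP.n∸n≡0 u))
                 (drop-one (+ P u) (a (idx u)))
      where
      drop-one : ∀ P a → P * + 1 * a ≡ P * a
      drop-one = solve-∀

  telescope : ∀ u → + P u * N u ≡ + Λ u * N₀ - S u * + D
  telescope zero = trans (cong (+ 1 *_) (cong ℚ.↥_ n-start)) (no-sum (+ 1 * N₀) (+ D))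
    where
    no-sum : ∀ x D → x ≡ x - + 0 * D
    no-sum = solve-∀
  telescope (suc u) = begin
    + P (suc u) * N (suc u)
      ≡⟨ cong (_* N (suc u)) P-step ⟩
    (+ P u * + M u) * N (suc u)
      ≡⟨ telescope-step (+ P u) (+ M u) (N (suc u)) (N u) (+ E u) (+ Λ u) N₀ (S u) (a (idx u)) (+ D)
           (numerator-step u) (telescope u) ⟩
    (+ E u * + Λ u) * N₀ - (+ E u * S u + + P u * a (idx u)) * + D
      ≡⟨ cong₂ (λ x y → x * N₀ - y * + D) (trans (sym (ℤP.pos-* (E u) (Λ u))) (cong +_ (Λ-step u))) (sym (S-step u)) ⟩
    + Λ (suc u) * N₀ - S (suc u) * + D
      ∎
    where
    open ≡-Reasoning
    P-step : + P (suc u) ≡ + P u * + M u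
    P-step = trans (cong +_ (ℕP.^-distribˡ-+-* m (Fsum f (+ v) u) (f (idx u)))) (ℤP.pos-* (P u) (M u))

  m-expansion : ∀ u → ℚ.↧ₙ (k (+ v) u) ≡ D × N₀ ≡ + P u * K u + + mres m f d (+ v) u * + D
  m-expansion = radix-expansion m (λ y → f (+ v + + y)) (d (+ v)) (n (+ v)) (k (+ v)) (k-start (+ v))
                  (λ u → proj₁ (k-step (+ v) u)) (λ u → proj₁ (proj₂ (proj₂ (k-step (+ v) u))))

  K-step : ∀ u → K u ≡ + M u * K (suc u) + + d (+ v) u * + D
  K-step u with digit-numerators (+ M u) (+ d (+ v) u) (k (+ v) u) (k (+ v) (suc u))
                  (coprime-^ (f (idx u)) (proj₁ (proj₂ (proj₂ (k-step (+ v) u)))))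
                  (proj₁ (k-step (+ v) u))
  ... | _ , K≡ rewrite proj₁ (m-expansion u) = K≡

  carry-invariant : ∀ u → ∃[ c ] c ℕ.< Λ u × N u ≡ + Λ u * K u + + c * + D
  carry-invariant zero =
    0 , ℕ.s≤s ℕ.z≤n , trans (cong ℚ.↥_ (trans n-start (sym (k-start (+ v))))) (trivial (K 0) (+ D))
    where
    trivial : ∀ K D → K ≡ + 1 * K + + 0 * D
    trivial = solve-∀
  carry-invariant (suc u) with carry-invariant u | orbit-numerators u
  ... | c , c<Λ , N≡ΛK+cD | Q , N≡ , N'≡ =
    subst (λ L → ∃[ c' ] c' ℕ.< L × N (suc u) ≡ + L * K (suc u) + + c' * + D) (Λ-step u)
      (carry-step {M = M u} {L = Λ u} {E = E u} {D = D} {s = s (idx u)} {d = d (+ v) u} {c = c} {r = r (idx u)}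
                  {Q = Q} {K = K u} {K' = K (suc u)} {N = N u} {N' = N (suc u)}
                  (ℕC.sym (coprime-^ (f (idx u)) (proj₁ (n∈Zml (+ v)))))
                  (s<M (idx u)) (proj₁ (proj₂ (k-step (+ v) u))) c<Λ (r<E (idx u))
                  N≡ N'≡ (K-step u) N≡ΛK+cD)

  module OnePeriod (τ : ℕ) (e-periodic : Periodic τ e) (n-periodic : Periodic τ n) where

    L : ℕ
    L = l ℕ.^ Ebar e (+ v) τ

    L⊥D : Coprime L D
    L⊥D = ℕC.sym (coprime-^ (Ebar e (+ v) τ) (proj₂ (n∈Zml (+ v))))

    Λ-period : Λ τ ≡ L
    Λ-period = cong (l ℕ.^_) (Ebar-periodic e e-periodic (+ v) τ)

    N-period : N τ ≡ N₀
    N-period = cong ℚ.↥_ (n-periodic (+ v))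

    S-period : S τ ≡ Nv m l τ f e a (+ v)
    S-period = sumℤ-cong τ (λ w _ → cong (λ x → + P w * + (l ℕ.^ x) * a (+ v + + w))
                                           (Ebar-periodic e e-periodic (+ v) (τ ℕ.∸ 1 ℕ.∸ w)))

    telescoped : + P τ * N₀ ≡ + L * N₀ - Nv m l τ f e a (+ v) * + D
    telescoped = begin
      + P τ * N₀                                ≡⟨ cong (+ P τ *_) (sym N-period) ⟩
      + P τ * N τ                               ≡⟨ telescope τ ⟩
      + Λ τ * N₀ - S τ * + D                ≡⟨ cong₂ (λ x y → + x * N₀ - y * + D) Λ-period S-period ⟩
      + L * N₀ - Nv m l τ f e a (+ v) * + D ∎
      where open ≡-Reasoning

    carried : ∃[ c ] c ℕ.< L × N₀ ≡ + L * K τ + + c * + D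
    carried = subst₂ (λ N′ L′ → ∃[ c ] c ℕ.< L′ × N′ ≡ + L′ * K τ + + c * + D)
                N-period Λ-period (carry-invariant τ)

theorem4p9 :
    (m l τ : ℕ) → 2 ℕ.≤ m → 2 ℕ.≤ l → Coprime m l → 1 ℕ.≤ τ →
    (f : ℤ → ℕ) → Periodic τ f → (∀ v → 1 ℕ.≤ f v) →
    (A : ℤ → ℕ → ℤ) → Periodic τ A →
    (∀ v → A v 0 ≡ + 0) →
    (∀ v i → 1 ℕ.≤ i → i ℕ.< l →
       (+ l ℤD.∣ (A v i ℤ.+ + (m ℕ.^ f v) ℤ.* + i))
       × ¬ (+ m ℤD.∣ A v i) × ¬ (+ l ℤD.∣ A v i)) →
    (iv s e r : ℤ → ℕ) →
    Periodic τ iv → Periodic τ s → Periodic τ e → Periodic τ r →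
    (∀ v → 1 ℕ.≤ iv v × iv v ℕ.< l) →
    (∀ v → 1 ℕ.≤ s v × s v ℕ.≤ m ℕ.^ f v ℕ.∸ 1 × Coprime (s v) m) →
    (∀ v → 1 ℕ.≤ e v × 1 ℕ.≤ r v) →
    (∀ v → + l ℤD.∣ (+ r v ℤ.- + iv v)) →
    (∀ v → + (l ℕ.^ e v) ℤ.* + s v ≡ + (m ℕ.^ f v) ℤ.* + r v ℤ.+ A v (iv v)) →
    (∀ v → ℤ.∣ A v (iv v) ∣ ℕ.< (m ℕ.^ f v) ℕ.⊔ (l ℕ.^ e v)) →
    -- the τ-periodic sequence of iterates n_v in ℤ_⟨m,l⟩
    (n : ℤ → ℚ) → Periodic τ n → (∀ v → InZml m l (n v)) →
    (∀ v → Σ ℚ λ q → InZml m l q × n v ≡ ι (+ (m ℕ.^ f v)) ℚ.* q ℚ.+ ι (+ s v)) →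
    (∀ v → n (v ℤ.+ + 1) ℚ.* ι (+ (m ℕ.^ f v))
           ≡ ι (+ (l ℕ.^ e v)) ℚ.* (n v ℚ.- ι (+ s v)) ℚ.+ ι (+ r v) ℚ.* ι (+ (m ℕ.^ f v))) →
    -- graded m-digits
    (k : ℤ → ℕ → ℚ) (d : ℤ → ℕ → ℕ) →
    (∀ v → k v 0 ≡ n v) →
    (∀ v u → k v u ≡ ι (+ (m ℕ.^ f (v ℤ.+ + u))) ℚ.* k v (suc u) ℚ.+ ι (+ d v u)
             × d v u ℕ.< m ℕ.^ f (v ℤ.+ + u) × InZml m l (k v (suc u))) →
    -- graded l-digits
    (j : ℤ → ℕ → ℚ) (b : ℤ → ℕ → ℕ) →
    (∀ v → j v 0 ≡ n v) →
    (∀ v u → j v u ≡ ι (+ (l ℕ.^ e (v ℤ.- + 1 ℤ.- + u))) ℚ.* j v (suc u) ℚ.+ ι (+ b v u)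
             × b v u ℕ.< l ℕ.^ e (v ℤ.- + 1 ℤ.- + u) × InZml m l (j v (suc u))) →
    ∀ (v : ℕ) → v ℕ.< τ →
    Nv m l τ f e (λ w → A w (iv w)) (+ v)
      ≡ + (l ℕ.^ Ebar e (+ v) τ) ℤ.* + (mres m f d (+ v) τ)
        ℤ.- + (m ℕ.^ Fsum f (+ v) τ) ℤ.* + (lres l e b (+ v) τ)
theorem4p9 m l τ 2≤m 2≤l _ _ f _ _ A _ _ A-digits iv s e r _ _ e-periodic _ iv-range s-range e-r-positive _
           carry-relation |a|-bound n n-periodic n∈Zml n-digit n-step k d k-start k-step j b j-start j-step v _ =
  residue-identity {L} {P τ} {D} {mres m f d (+ v) τ} {lres l e b (+ v) τ}
    N₀ (K τ) (ℚ.↥ (j (+ v) τ)) (Nv m l τ f e a (+ v)) L⊥D (radix-value-bound l g (b (+ v)) b<l^g τ)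
    telescoped (proj₂ (m-expansion τ)) (proj₂ l-expansion) carried
  where
  instance
    m≢0 : ℕ.NonZero m
    m≢0 = ℕ.>-nonZero (ℕP.≤-trans (ℕ.s≤s ℕ.z≤n) 2≤m)
    l≢0 : ℕ.NonZero l
    l≢0 = ℕ.>-nonZero (ℕP.≤-trans (ℕ.s≤s ℕ.z≤n) 2≤l)
  a : ℤ → ℤ
  a w = A w (iv w)
  s<M : ∀ w → s w ℕ.< m ℕ.^ f w
  s<M w = subst (s w ℕ.<_) (ℕP.suc-pred (m ℕ.^ f w) {{ℕP.m^n≢0 m (f w)}})
                (ℕ.s≤s (proj₁ (proj₂ (s-range w))))
  -- the carries stay below l^{e_w}, since a_w is not divisible by l
  r<E : ∀ w → r w ℕ.< l ℕ.^ e w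
  r<E w = carry-bound (a w) (∣-power l (proj₁ (e-r-positive w))) (s<M w) l∤a (carry-relation w) (|a|-bound w)
    where
    l∤a : ¬ (+ l ℤD.∣ a w)
    l∤a = proj₂ (proj₂ (A-digits w (iv w) (proj₁ (iv-range w)) (proj₂ (iv-range w))))
  open Orbit m l f e s r a n k d n∈Zml n-digit n-step carry-relation s<M r<E k-start k-step v
  open OnePeriod τ e-periodic n-periodic
  g : ℕ → ℕ
  g y = e (+ v - + 1 - + y)
  b<l^g : ∀ w → b (+ v) w ℕ.< l ℕ.^ g w
  b<l^g w = proj₁ (proj₂ (j-step (+ v) w))
  l-expansion : ℚ.↧ₙ (j (+ v) τ) ≡ D × N₀ ≡ + L * ℚ.↥ (j (+ v) τ) + + lres l e b (+ v) τ * + D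
  l-expansion = radix-expansion l g (b (+ v)) (n (+ v)) (j (+ v)) (j-start (+ v))
                  (λ u → proj₁ (j-step (+ v) u)) (λ u → proj₂ (proj₂ (proj₂ (j-step (+ v) u)))) τ
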